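{- Let $\mathbb F$ be a field, let $\varphi$ be an $\mathbb F^\times$-gain function on $2C_4''$ such that no 2-cycle is balanced with respect to $\varphi$, and let $\psi$ be any $\mathbb F^\times$-gain function on $2C_4''$. Then $A_F(2C_4'',\varphi)$ and $A_F(2C_4'',\psi)$ are projectively equivalent if and only if $\varphi$ and $\psi$ are switching equivalent.
   Context: $2C_4''$ is the graph obtained from a 4-cycle by doubling each edge of one pair of opposite edges. An $\mathbb F^\times$-gain function assigns nonzero scalars to oriented edges with $\varphi(e^{ -1})=\varphi(e)^{ -1}$; a cycle is balanced if its gain product is $1$. Switching: $\varphi^\eta(e)=\eta(\mathrm{tail}\,e)^{ -1}\varphi(e)\eta(\mathrm{head}\,e)$. Frame matrix $A_F(G,\varphi)$: rows $V(G)$, columns $E(G)$, link column $\hat{\mathrm{tail}(e)}-\varphi(e)\hat{\mathrm{head}(e)}$. Projectively equivalent: related by elementary row operations, nonzero column scalings, and deleting/adjoining zero rows. -}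

module Defs where

open import Level using (Level; _⊔_) renaming (suc to lsuc)
open import Algebra.Bundles using (CommutativeRing)
open import Data.Nat using (ℕ)
open import Data.Fin using (Fin; zero; suc; _≟_)
open import Data.Product using (Σ; ∃; _×_; _,_)
open import Relation.Nullary using (¬_; yes; no)
open import Relation.Binary.PropositionalEquality using (_≡_)

record Field (c ℓ : Level) : Set (lsuc (c ⊔ ℓ)) where
  field
    commutativeRing : CommutativeRing c ℓ
  open CommutativeRing commutativeRing public
  field
    _⁻¹         : Carrier → Carrier
    1≉0         : ¬ (1# ≈ 0#)
    inverseʳ    : ∀ x → ¬ (x ≈ 0#) → (x * (x ⁻¹)) ≈ 1#

-- The graph 2C₄'' : the 4-cycle 0-1-2-3-0 with the opposite edges
-- {0,1} and {2,3} doubled.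

V : Set
V = Fin 4

E : Set
E = Fin 6

v0 v1 v2 v3 : V
v0 = zero
v1 = suc zero
v2 = suc (suc zero)
v3 = suc (suc (suc zero))

e0 e1 e2 e3 e4 e5 : E
e0 = zero
e1 = suc zero
e2 = suc (suc zero)
e3 = suc (suc (suc zero))
e4 = suc (suc (suc (suc zero)))
e5 = suc (suc (suc (suc (suc zero))))

tail : E → V
tail zero = v0
tail (suc zero) = v0
tail (suc (suc zero)) = v1
tail (suc (suc (suc zero))) = v2
tail (suc (suc (suc (suc zero)))) = v2
tail (suc (suc (suc (suc (suc zero))))) = v3

head : E → V
head zero = v1
head (suc zero) = v1
head (suc (suc zero)) = v2
head (suc (suc (suc zero))) = v3
head (suc (suc (suc (suc zero)))) = v3
head (suc (suc (suc (suc (suc zero))))) = v0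

module _ {c ℓ : Level} (F : Field c ℓ) where
  open Field F

  NonZero : Carrier → Set ℓ
  NonZero x = ¬ (x ≈ 0#)

  -- An F^×-gain function on 2C₄'': a nonzero scalar on each edge in its
  -- reference orientation; the reverse orientation gets the inverse,
  -- φ(e⁻¹) = φ(e)⁻¹.

  record GainFunction : Set (c ⊔ ℓ) where
    constructor gain
    field
      φ       : E → Carrier
      φ-nonzero : ∀ e → NonZero (φ e)
  open GainFunction public

  -- The 2-cycles of 2C₄'' are e0 e1⁻¹ and e3 e4⁻¹ (the only pairs of
  -- parallel edges).  Gain of the cycle e e'⁻¹ is φ(e) φ(e')⁻¹.
  twoCycleGain : GainFunction → E → E → Carrier
  twoCycleGain g e e' = φ g e * (φ g e' ⁻¹)

  BalancedTwoCycle : GainFunction → E → E → Set ℓ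
  BalancedTwoCycle g e e' = twoCycleGain g e e' ≈ 1#

  NoBalancedTwoCycle : GainFunction → Set ℓ
  NoBalancedTwoCycle g = ¬ BalancedTwoCycle g e0 e1 × ¬ BalancedTwoCycle g e3 e4

  switch : (V → Carrier) → GainFunction → E → Carrier
  switch η g e = ((η (tail e) ⁻¹) * φ g e) * η (head e)

  SwitchingEquivalent : GainFunction → GainFunction → Set (c ⊔ ℓ)
  SwitchingEquivalent g h =
    Σ (V → Carrier) λ η → (∀ v → NonZero (η v)) × (∀ e → φ h e ≈ switch η g e)

  Matrix : ℕ → ℕ → Set c
  Matrix m n = Fin m → Fin n → Carrier

  -- Frame matrix A_F(2C₄'', φ): rows V, columns E; column of e is
  -- \hat{tail e} − φ(e) \hat{head e}  (all edges are links).
  frameMatrix : GainFunction → Matrix 4 6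
  frameMatrix g v e with v ≟ tail e | v ≟ head e
  ... | yes _ | _     = 1#
  ... | no _  | yes _ = - φ g e
  ... | no _  | no _  = 0#

  swapRows : ∀ {m n} → Fin m → Fin m → Matrix m n → Matrix m n
  swapRows i j A r with r ≟ i | r ≟ j
  ... | yes _ | _     = A j
  ... | no _  | yes _ = A i
  ... | no _  | no _  = A r

  scaleRow : ∀ {m n} → Fin m → Carrier → Matrix m n → Matrix m n
  scaleRow i a A r k with r ≟ i
  ... | yes _ = a * A r k
  ... | no _  = A r k

  addRow : ∀ {m n} → Fin m → Fin m → Carrier → Matrix m n → Matrix m n
  addRow i j a A r k with r ≟ i
  ... | yes _ = A r k + (a * A j k)
  ... | no _  = A r k

  scaleColumn : ∀ {m n} → Fin n → Carrier → Matrix m n → Matrix m n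
  scaleColumn j a A r k with k ≟ j
  ... | yes _ = A r k * a
  ... | no _  = A r k

  adjoinZeroRow : ∀ {m n} → Matrix m n → Matrix (ℕ.suc m) n
  adjoinZeroRow A zero    k = 0#
  adjoinZeroRow A (suc r) k = A r k

  -- Row order of a zero row is
  -- immaterial since row swaps are available.
  data ProjEquiv {n : ℕ} : ∀ {m m'} → Matrix m n → Matrix m' n → Set (c ⊔ ℓ) where
    pe-≈     : ∀ {m} {A B : Matrix m n} → (∀ r k → A r k ≈ B r k) → ProjEquiv A B
    pe-sym   : ∀ {m m'} {A : Matrix m n} {B : Matrix m' n} → ProjEquiv A B → ProjEquiv B A
    pe-trans : ∀ {m m' m''} {A : Matrix m n} {B : Matrix m' n} {C : Matrix m'' n} →
               ProjEquiv A B → ProjEquiv B C → ProjEquiv A C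
    pe-swap  : ∀ {m} (A : Matrix m n) (i j : Fin m) → ProjEquiv A (swapRows i j A)
    pe-scaleRow : ∀ {m} (A : Matrix m n) (i : Fin m) (a : Carrier) → NonZero a →
                  ProjEquiv A (scaleRow i a A)
    pe-addRow : ∀ {m} (A : Matrix m n) (i j : Fin m) (a : Carrier) → ¬ (i ≡ j) →
                ProjEquiv A (addRow i j a A)
    pe-scaleColumn : ∀ {m} (A : Matrix m n) (j : Fin n) (a : Carrier) → NonZero a →
                     ProjEquiv A (scaleColumn j a A)
    pe-zeroRow : ∀ {m} (A : Matrix m n) → ProjEquiv A (adjoinZeroRow A)

-- Projective equivalence preserves the null space of a matrix up to a rescaling of its coordinates
-- by nonzero column factors d. The frame matrix of 2C₄'' has an explicit null vector supported on the
-- tight handcuff {e0, …, e4}, and a second one, its image under the rotation v ↦ v + 2. Asking that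
-- both, rescaled by d, be annihilated by the frame matrix of ψ forces (because the 2-cycles of φ are
-- unbalanced) d to be constant on each pair of parallel edges, and then η(v) := d(e) for an edge e
-- leaving v switches φ into ψ. Conversely a switching η is realised by scaling row v by η(v) and
-- column e by η(tail e)⁻¹.
module Submission where

open import Algebra.Bundles using (CommutativeRing)
import Algebra.Solver.Ring
open import Algebra.Solver.Ring.AlmostCommutativeRing
  using (_-Raw-AlmostCommutative⟶_; fromCommutativeRing)
open import Data.Fin using (Fin; suc; _≟_)
open import Data.Fin.Patterns using (0F; 1F; 2F; 3F; 4F; 5F)
open import Data.Integer.Base as ℤ using (ℤ; +_; -[1+_]; _⊖_)
import Data.Integer.Properties as ℤ
open import Data.Maybe using (Maybe; just; nothing)
open import Data.Nat.Base as ℕ using (ℕ; suc)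
import Data.Nat.Properties as ℕ
open import Data.Vec.Functional using (Vector; _∷_; []; foldr)
open import Defs
open import Function using (_∘_; id)
open import Function.Bundles using (_⇔_; mk⇔; Equivalence)
open import Function.Construct.Composition using (_⇔-∘_)
open import Function.Construct.Symmetry using (⇔-sym)
open import Level using (Level; _⊔_)
open import Relation.Binary.PropositionalEquality as ≡ using (_≡_)
open import Relation.Nullary using (¬_; yes; no; contradiction)

open Equivalence using (to; from)

-- The ring solver needs coefficients whose arithmetic computes; ℤ maps into every commutative ring.
module IntegerCoefficients {c ℓ} (R : CommutativeRing c ℓ) where

  open CommutativeRing R
  open import Algebra.Properties.Ring ring using (-0#≈0#; -‿involutive; -‿+-comm; -‿distribˡ-*; -‿distribʳ-*)
  open import Algebra.Properties.CommutativeSemigroup +-commutativeSemigroup using (interchange)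
  open import Algebra.Properties.Semiring.Mult.TCOptimised semiring using (_×_; ×-homo-+; ×1-homo-*)
  open import Relation.Binary.Reasoning.Setoid setoid

  -- Optimised ℕ-multiples, so that the constants 0 and 1 of solver expressions evaluate to 0# and 1#.
  fromℤ : ℤ → Carrier
  fromℤ (+ n)    = n × 1#
  fromℤ -[1+ n ] = - (suc n × 1#)

  fromℤ-⊖ : ∀ m n → fromℤ (m ⊖ n) ≈ m × 1# - n × 1#
  fromℤ-⊖ m       0       = sym (trans (+-congˡ -0#≈0#) (+-identityʳ _))
  fromℤ-⊖ 0       (suc n) = sym (+-identityˡ _)
  fromℤ-⊖ (suc m) (suc n) = begin
    fromℤ (suc m ⊖ suc n)                  ≡⟨ ≡.cong fromℤ (ℤ.[1+m]⊖[1+n]≡m⊖n m n) ⟩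
    fromℤ (m ⊖ n)                          ≈⟨ fromℤ-⊖ m n ⟩
    m × 1# - n × 1#                        ≈⟨ +-identityˡ _ ⟨
    0# + (m × 1# - n × 1#)                 ≈⟨ +-congʳ (-‿inverseʳ 1#) ⟨
    (1# - 1#) + (m × 1# - n × 1#)          ≈⟨ interchange 1# (- 1#) (m × 1#) (- (n × 1#)) ⟩
    (1# + m × 1#) + (- 1# - n × 1#)        ≈⟨ +-cong (suc×1 m) (trans (-‿cong (suc×1 n)) (sym (-‿+-comm 1# _))) ⟨
    suc m × 1# - suc n × 1#                ∎
    where
    suc×1 : ∀ k → suc k × 1# ≈ 1# + k × 1#
    suc×1 = ×-homo-+ 1# 1

  fromℤ-+ : ∀ i j → fromℤ (i ℤ.+ j) ≈ fromℤ i + fromℤ j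
  fromℤ-+ (+ m)    (+ n)    = ×-homo-+ 1# m n
  fromℤ-+ (+ m)    -[1+ n ] = fromℤ-⊖ m (suc n)
  fromℤ-+ -[1+ m ] (+ n)    = trans (fromℤ-⊖ n (suc m)) (+-comm _ _)
  fromℤ-+ -[1+ m ] -[1+ n ] = begin
    - (suc (suc (m ℕ.+ n)) × 1#)           ≡⟨ ≡.cong (λ k → - (k × 1#)) (ℕ.+-suc (suc m) n) ⟨
    - ((suc m ℕ.+ suc n) × 1#)             ≈⟨ -‿cong (×-homo-+ 1# (suc m) (suc n)) ⟩
    - (suc m × 1# + suc n × 1#)            ≈⟨ -‿+-comm _ _ ⟨
    - (suc m × 1#) - suc n × 1#            ∎

  fromℤ-neg : ∀ i → fromℤ (ℤ.- i) ≈ - fromℤ i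
  fromℤ-neg (+ 0)     = sym -0#≈0#
  fromℤ-neg (+ suc n) = refl
  fromℤ-neg -[1+ n ]  = sym (-‿involutive _)

  fromℤ-*-pos : ∀ m j → fromℤ (+ m ℤ.* j) ≈ fromℤ (+ m) * fromℤ j
  fromℤ-*-pos m (+ n)    = trans (reflexive (≡.cong fromℤ (≡.sym (ℤ.pos-* m n)))) (×1-homo-* m n)
  fromℤ-*-pos m -[1+ n ] = begin
    fromℤ (+ m ℤ.* ℤ.- + suc n)            ≡⟨ ≡.cong fromℤ (ℤ.neg-distribʳ-* (+ m) (+ suc n)) ⟨
    fromℤ (ℤ.- (+ m ℤ.* + suc n))          ≈⟨ fromℤ-neg (+ m ℤ.* + suc n) ⟩
    - fromℤ (+ m ℤ.* + suc n)              ≈⟨ -‿cong (fromℤ-*-pos m (+ suc n)) ⟩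
    - (m × 1# * suc n × 1#)                ≈⟨ -‿distribʳ-* _ _ ⟩
    m × 1# * - (suc n × 1#)                ∎

  fromℤ-* : ∀ i j → fromℤ (i ℤ.* j) ≈ fromℤ i * fromℤ j
  fromℤ-* (+ m)    j = fromℤ-*-pos m j
  fromℤ-* -[1+ m ] j = begin
    fromℤ (ℤ.- + suc m ℤ.* j)              ≡⟨ ≡.cong fromℤ (ℤ.neg-distribˡ-* (+ suc m) j) ⟨
    fromℤ (ℤ.- (+ suc m ℤ.* j))            ≈⟨ fromℤ-neg (+ suc m ℤ.* j) ⟩
    - fromℤ (+ suc m ℤ.* j)                ≈⟨ -‿cong (fromℤ-*-pos (suc m) j) ⟩
    - (suc m × 1# * fromℤ j)               ≈⟨ -‿distribˡ-* _ _ ⟩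
    - (suc m × 1#) * fromℤ j               ∎

  homomorphism : ℤ.+-*-rawRing -Raw-AlmostCommutative⟶ fromCommutativeRing R
  homomorphism = record
    { ⟦_⟧    = fromℤ
    ; +-homo = fromℤ-+
    ; *-homo = fromℤ-*
    ; -‿homo = fromℤ-neg
    ; 0-homo = refl
    ; 1-homo = refl
    }

  fromℤ-≟ : ∀ i j → Maybe (fromℤ i ≈ fromℤ j)
  fromℤ-≟ i j with i ℤ.≟ j
  ... | yes ≡.refl = just refl
  ... | no _       = nothing

  open Algebra.Solver.Ring ℤ.+-*-rawRing (fromCommutativeRing R) homomorphism fromℤ-≟ public

module _ {c ℓ : Level} (F : Field c ℓ) where

  open Field F
  open import Data.Product using (Σ; _×_; _,_; proj₁; proj₂)
  open import Algebra.Properties.Ring ring using (x∙y⁻¹≈ε⇒x≈y; x≈y⇒x∙y⁻¹≈ε)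
  open import Algebra.Properties.Semiring.Sum semiring
    using (sum; sum-cong-≋; *-distribˡ-sum; ∑-distrib-+; sum-replicate-zero)
  open import Relation.Binary.Reasoning.Setoid setoid
  open IntegerCoefficients commutativeRing using (Polynomial; solve; _:=_; _:+_; _:-_; _:*_; :-_; con)

  𝟎 𝟏 : ∀ {k} → Polynomial k
  𝟎 = con (+ 0)
  𝟏 = con (+ 1)

  x⁻¹*x≈1 : ∀ {x} → NonZero F x → x ⁻¹ * x ≈ 1#
  x⁻¹*x≈1 {x} x≉0 = trans (*-comm (x ⁻¹) x) (inverseʳ x x≉0)

  x*y≈z⇒y≈x⁻¹*z : ∀ {x y z} → NonZero F x → x * y ≈ z → y ≈ x ⁻¹ * z
  x*y≈z⇒y≈x⁻¹*z {x} {y} {z} x≉0 xy≈z = begin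
    y               ≈⟨ *-identityˡ y ⟨
    1# * y          ≈⟨ *-congʳ (x⁻¹*x≈1 x≉0) ⟨
    x ⁻¹ * x * y    ≈⟨ *-assoc (x ⁻¹) x y ⟩
    x ⁻¹ * (x * y)  ≈⟨ *-congˡ xy≈z ⟩
    x ⁻¹ * z        ∎

  x*y≈0⇒y≈0 : ∀ {x y} → NonZero F x → x * y ≈ 0# → y ≈ 0#
  x*y≈0⇒y≈0 {x} x≉0 xy≈0 = trans (x*y≈z⇒y≈x⁻¹*z x≉0 xy≈0) (zeroʳ (x ⁻¹))

  x*[y-z]≈0⇒y≈z : ∀ {x y z} → NonZero F x → x * (y - z) ≈ 0# → y ≈ z
  x*[y-z]≈0⇒y≈z {y = y} {z} x≉0 h = x∙y⁻¹≈ε⇒x≈y y z (x*y≈0⇒y≈0 x≉0 h)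

  *-nonZero : ∀ {x y} → NonZero F x → NonZero F y → NonZero F (x * y)
  *-nonZero x≉0 y≉0 xy≈0 = y≉0 (x*y≈0⇒y≈0 x≉0 xy≈0)

  ⁻¹-nonZero : ∀ {x} → NonZero F x → NonZero F (x ⁻¹)
  ⁻¹-nonZero {x} x≉0 x⁻¹≈0 = 1≉0 (begin
    1#         ≈⟨ inverseʳ x x≉0 ⟨
    x * x ⁻¹   ≈⟨ *-congˡ x⁻¹≈0 ⟩
    x * 0#     ≈⟨ zeroʳ x ⟩
    0#         ∎)

  x+y*z≈0⇒x≈0 : ∀ {x y z} → z ≈ 0# → x + y * z ≈ 0# → x ≈ 0#
  x+y*z≈0⇒x≈0 {x} {y} {z} z≈0 h = begin
    x           ≈⟨ +-identityʳ x ⟨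
    x + 0#      ≈⟨ +-congˡ (trans (*-congˡ z≈0) (zeroʳ y)) ⟨
    x + y * z   ≈⟨ h ⟩
    0#          ∎

  x≈0⇒z≈0⇒x+y*z≈0 : ∀ {x y z} → x ≈ 0# → z ≈ 0# → x + y * z ≈ 0#
  x≈0⇒z≈0⇒x+y*z≈0 {y = y} x≈0 z≈0 =
    trans (+-cong x≈0 (trans (*-congˡ z≈0) (zeroʳ y))) (+-identityʳ 0#)

  proportional : ∀ {a a' X Y D} → NonZero F (a - a') →
    X * a' ≈ Y * a → (a - a') * D ≈ X - Y → X ≈ a * D × Y ≈ a' * D
  proportional {a} {a'} {X} {Y} {D} a≉a' Xa'≈Ya [a-a']D≈X-Y =
    x*[y-z]≈0⇒y≈z a≉a' (trans X-identity (x≈0⇒z≈0⇒x+y*z≈0 Ya-Xa'≈0 D-equation)) ,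
    x*[y-z]≈0⇒y≈z a≉a' (trans Y-identity (x≈0⇒z≈0⇒x+y*z≈0 Ya-Xa'≈0 D-equation))
    where
    Ya-Xa'≈0 : Y * a - X * a' ≈ 0#
    Ya-Xa'≈0 = x≈y⇒x∙y⁻¹≈ε (sym Xa'≈Ya)
    D-equation : (a - a') * D - (X - Y) ≈ 0#
    D-equation = x≈y⇒x∙y⁻¹≈ε [a-a']D≈X-Y
    X-identity : (a - a') * (X - a * D) ≈ (Y * a - X * a') + (- a) * ((a - a') * D - (X - Y))
    X-identity = solve 5 (λ a a' X Y D →
      (a :- a') :* (X :- a :* D) := (Y :* a :- X :* a') :+ (:- a) :* ((a :- a') :* D :- (X :- Y)))
      refl a a' X Y D
    Y-identity : (a - a') * (Y - a' * D) ≈ (Y * a - X * a') + (- a') * ((a - a') * D - (X - Y))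
    Y-identity = solve 5 (λ a a' X Y D →
      (a :- a') :* (Y :- a' :* D) := (Y :* a :- X :* a') :+ (:- a') :* ((a :- a') :* D :- (X :- Y)))
      refl a a' X Y D

  dot : ∀ {n} → Vector Carrier n → Vector Carrier n → Carrier
  dot a x = sum (λ k → a k * x k)

  dot-*ˡ : ∀ {n} c (a x : Vector Carrier n) → dot (λ k → c * a k) x ≈ c * dot a x
  dot-*ˡ {n} c a x =
    trans (sum-cong-≋ {n} (λ k → *-assoc c (a k) (x k))) (sym (*-distribˡ-sum c (λ k → a k * x k)))

  dot-+ˡ : ∀ {n} (a b x : Vector Carrier n) → dot (λ k → a k + b k) x ≈ dot a x + dot b x
  dot-+ˡ {n} a b x = trans (sum-cong-≋ {n} (λ k → distribʳ (x k) (a k) (b k)))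
                           (∑-distrib-+ (λ k → a k * x k) (λ k → b k * x k))

  dot-zeroˡ : ∀ {n} (x : Vector Carrier n) → dot (λ _ → 0#) x ≈ 0#
  dot-zeroˡ {n} x = trans (sum-cong-≋ {n} (λ k → zeroˡ (x k))) (sum-replicate-zero n)

  _⊙_ : ∀ {n} → Vector Carrier n → Vector Carrier n → Vector Carrier n
  (d ⊙ x) k = d k * x k

  -- A record rather than a Π-type, so that A and x can be inferred from a membership proof.
  record InNullSpace {m n} (A : Matrix F m n) (x : Vector Carrier n) : Set ℓ where
    constructor rowsAnnihilate
    field annihilates : ∀ r → dot (A r) x ≈ 0#
  open InNullSpace public

  module _ {m n : ℕ} where

    inNullSpace-congˡ : ∀ {A B : Matrix F m n} {x} → (∀ r k → A r k ≈ B r k) →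
      InNullSpace A x → InNullSpace B x
    annihilates (inNullSpace-congˡ A≈B Ax≈0) r =
      trans (sum-cong-≋ {n} (λ k → *-congʳ (sym (A≈B r k)))) (annihilates Ax≈0 r)

    inNullSpace-congʳ : ∀ {A : Matrix F m n} {x y} → (∀ k → x k ≈ y k) →
      InNullSpace A x → InNullSpace A y
    annihilates (inNullSpace-congʳ x≈y Ax≈0) r =
      trans (sum-cong-≋ {n} (λ k → *-congˡ (sym (x≈y k)))) (annihilates Ax≈0 r)

    inNullSpace-cong-⇔ : ∀ {A : Matrix F m n} {x y} → (∀ k → x k ≈ y k) →
      InNullSpace A x ⇔ InNullSpace A y
    inNullSpace-cong-⇔ x≈y = mk⇔ (inNullSpace-congʳ x≈y) (inNullSpace-congʳ (λ k → sym (x≈y k)))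

    swapRows-inNullSpace : ∀ {A : Matrix F m n} {x} i j →
      InNullSpace A x → InNullSpace (swapRows F i j A) x
    annihilates (swapRows-inNullSpace i j Ax≈0) r with r ≟ i | r ≟ j
    ... | yes _ | _     = annihilates Ax≈0 j
    ... | no _  | yes _ = annihilates Ax≈0 i
    ... | no _  | no _  = annihilates Ax≈0 r

    scaleRow-inNullSpace : ∀ {A : Matrix F m n} {x} i a →
      InNullSpace A x → InNullSpace (scaleRow F i a A) x
    annihilates (scaleRow-inNullSpace {A} {x} i a Ax≈0) r with r ≟ i
    ... | yes _ = trans (dot-*ˡ a (A r) x) (trans (*-congˡ (annihilates Ax≈0 r)) (zeroʳ a))
    ... | no _  = annihilates Ax≈0 r

    addRow-inNullSpace : ∀ {A : Matrix F m n} {x} i j a →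
      InNullSpace A x → InNullSpace (addRow F i j a A) x
    annihilates (addRow-inNullSpace {A} {x} i j a Ax≈0) r with r ≟ i
    ... | yes _ = begin
      dot (λ k → A r k + a * A j k) x        ≈⟨ dot-+ˡ (A r) _ x ⟩
      dot (A r) x + dot (λ k → a * A j k) x  ≈⟨ +-cong (annihilates Ax≈0 r) (dot-*ˡ a (A j) x) ⟩
      0# + a * dot (A j) x                   ≈⟨ x≈0⇒z≈0⇒x+y*z≈0 refl (annihilates Ax≈0 j) ⟩
      0#                                     ∎
    ... | no _  = annihilates Ax≈0 r

    -- In a composite of two row operations the inner one sits under a λ, where `with` cannot
    -- abstract r ≟ i; the following lemmas evaluate it instead.
    swapRows-at-i : ∀ (A : Matrix F m n) i j → swapRows F i j A i ≡ A j
    swapRows-at-i A i j with i ≟ i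
    ... | yes _  = ≡.refl
    ... | no i≢i = contradiction ≡.refl i≢i

    swapRows-at-j : ∀ (A : Matrix F m n) i j → swapRows F i j A j ≡ A i
    swapRows-at-j A i j with j ≟ i | j ≟ j
    ... | yes j≡i | _      = ≡.cong A j≡i
    ... | no _    | yes _  = ≡.refl
    ... | no _    | no j≢j = contradiction ≡.refl j≢j

    swapRows-other : ∀ (A : Matrix F m n) i j {r} → ¬ r ≡ i → ¬ r ≡ j → swapRows F i j A r ≡ A r
    swapRows-other A i j {r} r≢i r≢j with r ≟ i | r ≟ j
    ... | yes r≡i | _       = contradiction r≡i r≢i
    ... | no _    | yes r≡j = contradiction r≡j r≢j
    ... | no _    | no _    = ≡.refl

    swapRows-involutive : ∀ (A : Matrix F m n) i j r → swapRows F i j (swapRows F i j A) r ≡ A r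
    swapRows-involutive A i j r with r ≟ i | r ≟ j
    ... | yes ≡.refl | _          = swapRows-at-j A r j
    ... | no _       | yes ≡.refl = swapRows-at-i A i r
    ... | no r≢i     | no r≢j     = swapRows-other A i j r≢i r≢j

    scaleRow-at : ∀ (A : Matrix F m n) i a k → scaleRow F i a A i k ≡ a * A i k
    scaleRow-at A i a k with i ≟ i
    ... | yes _  = ≡.refl
    ... | no i≢i = contradiction ≡.refl i≢i

    scaleRow-other : ∀ (A : Matrix F m n) i a {r} → ¬ r ≡ i → scaleRow F i a A r ≡ A r
    scaleRow-other A i a {r} r≢i with r ≟ i
    ... | yes r≡i = contradiction r≡i r≢i
    ... | no _    = ≡.refl

    scaleRow-inverse : ∀ (A : Matrix F m n) i {a} → NonZero F a →
      ∀ r k → scaleRow F i (a ⁻¹) (scaleRow F i a A) r k ≈ A r k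
    scaleRow-inverse A i {a} a≉0 r k with r ≟ i
    ... | yes ≡.refl = begin
      a ⁻¹ * scaleRow F r a A r k  ≡⟨ ≡.cong (a ⁻¹ *_) (scaleRow-at A r a k) ⟩
      a ⁻¹ * (a * A r k)           ≈⟨ *-assoc _ a _ ⟨
      a ⁻¹ * a * A r k             ≈⟨ *-congʳ (x⁻¹*x≈1 a≉0) ⟩
      1# * A r k                   ≈⟨ *-identityˡ _ ⟩
      A r k                        ∎
    ... | no r≢i = reflexive (≡.cong (λ row → row k) (scaleRow-other A i a r≢i))

    addRow-at : ∀ (A : Matrix F m n) i j a k → addRow F i j a A i k ≡ A i k + a * A j k
    addRow-at A i j a k with i ≟ i
    ... | yes _  = ≡.refl
    ... | no i≢i = contradiction ≡.refl i≢i

    addRow-other : ∀ (A : Matrix F m n) i j a {r} → ¬ r ≡ i → addRow F i j a A r ≡ A r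
    addRow-other A i j a {r} r≢i with r ≟ i
    ... | yes r≡i = contradiction r≡i r≢i
    ... | no _    = ≡.refl

    addRow-inverse : ∀ (A : Matrix F m n) {i j} a → ¬ i ≡ j →
      ∀ r k → addRow F i j (- a) (addRow F i j a A) r k ≈ A r k
    addRow-inverse A {i} {j} a i≢j r k with r ≟ i
    ... | yes ≡.refl = begin
      addRow F r j a A r k + - a * addRow F r j a A j k
        ≡⟨ ≡.cong₂ (λ y z → y + - a * z) (addRow-at A r j a k)
                   (≡.cong (λ row → row k) (addRow-other A r j a (i≢j ∘ ≡.sym))) ⟩
      (A r k + a * A j k) + - a * A j k
        ≈⟨ cancel (A r k) a (A j k) ⟩
      A r k
        ∎
      where
      cancel : ∀ x a y → (x + a * y) + - a * y ≈ x
      cancel = solve 3 (λ x a y → (x :+ a :* y) :+ (:- a) :* y := x) refl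
    ... | no r≢i = reflexive (≡.cong (λ row → row k) (addRow-other A i j a r≢i))

  NullSpaceEquivalent : ∀ {m m' n} → Matrix F m n → Matrix F m' n → Set (c ⊔ ℓ)
  NullSpaceEquivalent {n = n} A B =
    Σ (Vector Carrier n) λ d → (∀ k → NonZero F (d k)) × (∀ x → InNullSpace A x ⇔ InNullSpace B (d ⊙ x))

  module _ {n : ℕ} where

    sameNullSpace : ∀ {m m'} {A : Matrix F m n} {B : Matrix F m' n} →
      (∀ {x} → InNullSpace A x → InNullSpace B x) → (∀ {x} → InNullSpace B x → InNullSpace A x) →
      NullSpaceEquivalent A B
    sameNullSpace A⊆B B⊆A = (λ _ → 1#) , (λ _ → 1≉0) , λ x → mk⇔
      (λ Ax≈0 → inNullSpace-congʳ (λ k → sym (*-identityˡ (x k))) (A⊆B Ax≈0))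
      (λ Bx≈0 → B⊆A (inNullSpace-congʳ (λ k → *-identityˡ (x k)) Bx≈0))

    nullSpaceEquivalent-sym : ∀ {m m'} {A : Matrix F m n} {B : Matrix F m' n} →
      NullSpaceEquivalent A B → NullSpaceEquivalent B A
    nullSpaceEquivalent-sym (d , d≉0 , A⇔B) = (λ k → d k ⁻¹) , (λ k → ⁻¹-nonZero (d≉0 k)) ,
      λ y → ⇔-sym (inNullSpace-cong-⇔ (cancel y) ⇔-∘ A⇔B (λ k → d k ⁻¹ * y k))
      where
      cancel : ∀ y k → d k * (d k ⁻¹ * y k) ≈ y k
      cancel y k =
        trans (sym (*-assoc _ _ _)) (trans (*-congʳ (inverseʳ (d k) (d≉0 k))) (*-identityˡ (y k)))

    nullSpaceEquivalent-trans :
      ∀ {m m' m''} {A : Matrix F m n} {B : Matrix F m' n} {C : Matrix F m'' n} →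
      NullSpaceEquivalent A B → NullSpaceEquivalent B C → NullSpaceEquivalent A C
    nullSpaceEquivalent-trans (d , d≉0 , A⇔B) (d' , d'≉0 , B⇔C) =
      (λ k → d' k * d k) , (λ k → *-nonZero (d'≉0 k) (d≉0 k)) , λ x →
      inNullSpace-cong-⇔ (λ k → sym (*-assoc (d' k) (d k) (x k))) ⇔-∘ (B⇔C (d ⊙ x) ⇔-∘ A⇔B x)

    columnRescaling : Fin n → Carrier → Vector Carrier n
    columnRescaling j a k with k ≟ j
    ... | yes _ = a ⁻¹
    ... | no _  = 1#

    scaleColumn-nullSpaceEquivalent : ∀ {m} (A : Matrix F m n) j {a} → NonZero F a →
      NullSpaceEquivalent A (scaleColumn F j a A)
    scaleColumn-nullSpaceEquivalent A j {a} a≉0 = columnRescaling j a , rescaling≉0 , λ x → mk⇔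
      (λ Ax≈0 → rowsAnnihilate λ r →
        trans (sum-cong-≋ {n} (λ k → termwise r k (x k))) (annihilates Ax≈0 r))
      (λ Bx≈0 → rowsAnnihilate λ r →
        trans (sum-cong-≋ {n} (λ k → sym (termwise r k (x k)))) (annihilates Bx≈0 r))
      where
      rescaling≉0 : ∀ k → NonZero F (columnRescaling j a k)
      rescaling≉0 k with k ≟ j
      ... | yes _ = ⁻¹-nonZero a≉0
      ... | no _  = 1≉0
      termwise : ∀ r k y → scaleColumn F j a A r k * (columnRescaling j a k * y) ≈ A r k * y
      termwise r k y with k ≟ j
      ... | yes _ = trans (rearrange (A r k) a (a ⁻¹) y)
                      (trans (*-congʳ (*-congˡ (inverseʳ a a≉0))) (*-congʳ (*-identityʳ (A r k))))
        where
        rearrange : ∀ x a b y → x * a * (b * y) ≈ x * (a * b) * y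
        rearrange = solve 4 (λ x a b y → x :* a :* (b :* y) := x :* (a :* b) :* y) refl
      ... | no _  = *-congˡ (*-identityˡ y)

  projEquiv⇒nullSpaceEquivalent : ∀ {m m' n} {A : Matrix F m n} {B : Matrix F m' n} →
    ProjEquiv F A B → NullSpaceEquivalent A B
  projEquiv⇒nullSpaceEquivalent (pe-≈ A≈B) =
    sameNullSpace (inNullSpace-congˡ A≈B) (inNullSpace-congˡ (λ r k → sym (A≈B r k)))
  projEquiv⇒nullSpaceEquivalent (pe-sym A∼B) =
    nullSpaceEquivalent-sym (projEquiv⇒nullSpaceEquivalent A∼B)
  projEquiv⇒nullSpaceEquivalent (pe-trans A∼B B∼C) =
    nullSpaceEquivalent-trans (projEquiv⇒nullSpaceEquivalent A∼B) (projEquiv⇒nullSpaceEquivalent B∼C)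
  projEquiv⇒nullSpaceEquivalent (pe-swap A i j) = sameNullSpace (swapRows-inNullSpace i j)
    (λ Bx≈0 → inNullSpace-congˡ
      (λ r k → reflexive (≡.cong (λ row → row k) (swapRows-involutive A i j r)))
      (swapRows-inNullSpace i j Bx≈0))
  projEquiv⇒nullSpaceEquivalent (pe-scaleRow A i a a≉0) = sameNullSpace (scaleRow-inNullSpace i a)
    (λ Bx≈0 → inNullSpace-congˡ (scaleRow-inverse A i a≉0) (scaleRow-inNullSpace i (a ⁻¹) Bx≈0))
  projEquiv⇒nullSpaceEquivalent (pe-addRow A i j a i≢j) = sameNullSpace (addRow-inNullSpace i j a)
    (λ Bx≈0 → inNullSpace-congˡ (addRow-inverse A a i≢j) (addRow-inNullSpace i j (- a) Bx≈0))
  projEquiv⇒nullSpaceEquivalent (pe-scaleColumn A j a a≉0) = scaleColumn-nullSpaceEquivalent A j a≉0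
  projEquiv⇒nullSpaceEquivalent (pe-zeroRow A) = sameNullSpace
    (λ {x} Ax≈0 → rowsAnnihilate λ { 0F → dot-zeroˡ x ; (suc r) → annihilates Ax≈0 r })
    (λ Bx≈0 → rowsAnnihilate λ r → annihilates Bx≈0 (suc r))

  gap : GainFunction F → E → E → Carrier
  gap g e e' = φ g e - φ g e'

  unbalanced⇒gap≉0 : ∀ g e e' → NonZero F (φ g e') → ¬ BalancedTwoCycle F g e e' →
    NonZero F (gap g e e')
  unbalanced⇒gap≉0 g e e' φe'≉0 unbalanced gap≈0 = unbalanced (begin
    φ g e * φ g e' ⁻¹   ≈⟨ *-congʳ (x∙y⁻¹≈ε⇒x≈y (φ g e) (φ g e') gap≈0) ⟩
    φ g e' * φ g e' ⁻¹  ≈⟨ inverseʳ (φ g e') φe'≉0 ⟩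
    1#                  ∎)

  frameApply : GainFunction F → (E → Carrier) → V → Carrier
  frameApply g x = (x e0 + x e1) - φ g e5 * x e5
                 ∷ x e2 - (φ g e0 * x e0 + φ g e1 * x e1)
                 ∷ (x e3 + x e4) - φ g e2 * x e2
                 ∷ x e5 - (φ g e3 * x e3 + φ g e4 * x e4)
                 ∷ []

  dot-frameMatrix : ∀ g x v → dot (frameMatrix F g v) x ≈ frameApply g x v
  dot-frameMatrix g x 0F = solve 7 (λ x₀ x₁ x₂ x₃ x₄ x₅ a₅ →
    𝟏 :* x₀ :+ (𝟏 :* x₁ :+ (𝟎 :* x₂ :+ (𝟎 :* x₃ :+ (𝟎 :* x₄ :+ ((:- a₅) :* x₅ :+ 𝟎))))) := x₀ :+ x₁ :- a₅ :* x₅)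
    refl (x e0) (x e1) (x e2) (x e3) (x e4) (x e5) (φ g e5)
  dot-frameMatrix g x 1F = solve 8 (λ x₀ x₁ x₂ x₃ x₄ x₅ a₀ a₁ →
    (:- a₀) :* x₀ :+ ((:- a₁) :* x₁ :+ (𝟏 :* x₂ :+ (𝟎 :* x₃ :+ (𝟎 :* x₄ :+ (𝟎 :* x₅ :+ 𝟎)))))
      := x₂ :- (a₀ :* x₀ :+ a₁ :* x₁))
    refl (x e0) (x e1) (x e2) (x e3) (x e4) (x e5) (φ g e0) (φ g e1)
  dot-frameMatrix g x 2F = solve 7 (λ x₀ x₁ x₂ x₃ x₄ x₅ a₂ →
    𝟎 :* x₀ :+ (𝟎 :* x₁ :+ ((:- a₂) :* x₂ :+ (𝟏 :* x₃ :+ (𝟏 :* x₄ :+ (𝟎 :* x₅ :+ 𝟎))))) := x₃ :+ x₄ :- a₂ :* x₂)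
    refl (x e0) (x e1) (x e2) (x e3) (x e4) (x e5) (φ g e2)
  dot-frameMatrix g x 3F = solve 8 (λ x₀ x₁ x₂ x₃ x₄ x₅ a₃ a₄ →
    𝟎 :* x₀ :+ (𝟎 :* x₁ :+ (𝟎 :* x₂ :+ ((:- a₃) :* x₃ :+ ((:- a₄) :* x₄ :+ (𝟏 :* x₅ :+ 𝟎)))))
      := x₅ :- (a₃ :* x₃ :+ a₄ :* x₄))
    refl (x e0) (x e1) (x e2) (x e3) (x e4) (x e5) (φ g e3) (φ g e4)

  inNullSpace-frameMatrix : ∀ g x → InNullSpace (frameMatrix F g) x ⇔ (∀ v → frameApply g x v ≈ 0#)
  inNullSpace-frameMatrix g x = mk⇔
    (λ Ax≈0 v → trans (sym (dot-frameMatrix g x v)) (annihilates Ax≈0 v))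
    (λ Ax≈0 → rowsAnnihilate λ v → trans (dot-frameMatrix g x v) (Ax≈0 v))

  -- Rotation by two vertices is an automorphism of 2C₄''; frameApply commutes with it definitionally,
  -- which is what lets each lemma below be reused for the rotated data.
  rotateE : E → E
  rotateE = e3 ∷ e4 ∷ e5 ∷ e0 ∷ e1 ∷ e2 ∷ []

  rotate : GainFunction F → GainFunction F
  rotate g = record { φ = φ g ∘ rotateE ; φ-nonzero = φ-nonzero g ∘ rotateE }

  -- The edges e0 … e4 form a tight handcuff (two unbalanced 2-cycles joined by the path e2), a circuit
  -- of the frame matroid; handcuff₂ is the corresponding null vector of the frame matrix.
  handcuff₂ : GainFunction F → E → Carrier
  handcuff₂ g = α ∷ - α ∷ γ * α ∷ - (φ g e4 * β) ∷ φ g e3 * β ∷ 0# ∷ []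
    where
    γ α β : Carrier
    γ = gap g e0 e1
    α = gap g e3 e4
    β = φ g e2 * γ

  handcuff₅ : GainFunction F → E → Carrier
  handcuff₅ g = handcuff₂ (rotate g) ∘ rotateE

  handcuff₂-null : ∀ g v → frameApply g (handcuff₂ g) v ≈ 0#
  handcuff₂-null g 0F = solve 2 (λ α a₅ → α :+ :- α :- a₅ :* 𝟎 := 𝟎) refl (gap g e3 e4) (φ g e5)
  handcuff₂-null g 1F = solve 3 (λ a₀ a₁ α → (a₀ :- a₁) :* α :- (a₀ :* α :+ a₁ :* (:- α)) := 𝟎)
    refl (φ g e0) (φ g e1) (gap g e3 e4)
  handcuff₂-null g 2F = solve 4 (λ γ a₂ a₃ a₄ →
    :- (a₄ :* (a₂ :* γ)) :+ a₃ :* (a₂ :* γ) :- a₂ :* (γ :* (a₃ :- a₄)) := 𝟎)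
    refl (gap g e0 e1) (φ g e2) (φ g e3) (φ g e4)
  handcuff₂-null g 3F = solve 3 (λ β a₃ a₄ → 𝟎 :- (a₃ :* (:- (a₄ :* β)) :+ a₄ :* (a₃ :* β)) := 𝟎)
    refl (φ g e2 * gap g e0 e1) (φ g e3) (φ g e4)

  handcuff₅-null : ∀ g v → frameApply g (handcuff₅ g) v ≈ 0#
  handcuff₅-null g 0F = handcuff₂-null (rotate g) 2F
  handcuff₅-null g 1F = handcuff₂-null (rotate g) 3F
  handcuff₅-null g 2F = handcuff₂-null (rotate g) 0F
  handcuff₅-null g 3F = handcuff₂-null (rotate g) 1F

  Intertwines : GainFunction F → GainFunction F → (V → Carrier) → E → Set ℓ
  Intertwines g h η e = η (tail e) * φ h e ≈ φ g e * η (head e)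

  intertwining⇒switchingEquivalent : ∀ g h η → (∀ v → NonZero F (η v)) →
    (∀ e → Intertwines g h η e) → SwitchingEquivalent F g h
  intertwining⇒switchingEquivalent g h η η≉0 intertwines = η , η≉0 , λ e →
    trans (x*y≈z⇒y≈x⁻¹*z (η≉0 (tail e)) (intertwines e)) (sym (*-assoc _ _ _))

  outEdge : V → E
  outEdge = e0 ∷ e2 ∷ e3 ∷ e5 ∷ []

  module _ (g h : GainFunction F) (d : E → Carrier) where

    parallelScalings-agree : NonZero F (gap g e3 e4) → frameApply h (d ⊙ handcuff₂ g) v0 ≈ 0# → d e0 ≈ d e1
    parallelScalings-agree α≉0 U₀ = x*[y-z]≈0⇒y≈z α≉0 (trans (sym expand) U₀)
      where
      expand : frameApply h (d ⊙ handcuff₂ g) v0 ≈ gap g e3 e4 * (d e0 - d e1)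
      expand = solve 5 (λ α d₀ d₁ b₅ d₅ → d₀ :* α :+ d₁ :* (:- α) :- b₅ :* (d₅ :* 𝟎) := α :* (d₀ :- d₁))
        refl (gap g e3 e4) (d e0) (d e1) (φ h e5) (d e5)

    parallelPair-intertwines : NonZero F (gap g e0 e1) → NonZero F (gap g e3 e4) → NonZero F (φ g e5) →
      d e0 ≈ d e1 → frameApply h (d ⊙ handcuff₂ g) v1 ≈ 0# → frameApply h (d ⊙ handcuff₅ g) v1 ≈ 0# →
      Intertwines g h (d ∘ outEdge) e0 × Intertwines g h (d ∘ outEdge) e1
    parallelPair-intertwines γ≉0 α≉0 a₅≉0 d₀≈d₁ U₁ W₁ =
      proj₁ solution , trans (*-congʳ d₀≈d₁) (proj₂ solution)
      where
      expandU : frameApply h (d ⊙ handcuff₂ g) v1 ≈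
                gap g e3 e4 * (gap g e0 e1 * d e2 - (d e0 * φ h e0 - d e1 * φ h e1))
      expandU = solve 7 (λ α γ b₀ b₁ d₀ d₁ d₂ →
        d₂ :* (γ :* α) :- (b₀ :* (d₀ :* α) :+ b₁ :* (d₁ :* (:- α))) := α :* (γ :* d₂ :- (d₀ :* b₀ :- d₁ :* b₁)))
        refl (gap g e3 e4) (gap g e0 e1) (φ h e0) (φ h e1) (d e0) (d e1) (d e2)
      expandW : frameApply h (d ⊙ handcuff₅ g) v1 ≈
                (φ g e5 * gap g e3 e4) * (d e0 * φ h e0 * φ g e1 - d e1 * φ h e1 * φ g e0)
      expandW = solve 8 (λ β a₀ a₁ b₀ b₁ d₀ d₁ d₂ →
        d₂ :* 𝟎 :- (b₀ :* (d₀ :* (:- (a₁ :* β))) :+ b₁ :* (d₁ :* (a₀ :* β)))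
          := β :* (d₀ :* b₀ :* a₁ :- d₁ :* b₁ :* a₀))
        refl (φ g e5 * gap g e3 e4) (φ g e0) (φ g e1) (φ h e0) (φ h e1) (d e0) (d e1) (d e2)
      solution : d e0 * φ h e0 ≈ φ g e0 * d e2 × d e1 * φ h e1 ≈ φ g e1 * d e2
      solution = proportional γ≉0
        (x*[y-z]≈0⇒y≈z (*-nonZero a₅≉0 α≉0) (trans (sym expandW) W₁))
        (x*[y-z]≈0⇒y≈z α≉0 (trans (sym expandU) U₁))

    bridge-intertwines : NonZero F (gap g e0 e1) → NonZero F (gap g e3 e4) → d e3 ≈ d e4 →
      frameApply h (d ⊙ handcuff₂ g) v2 ≈ 0# → Intertwines g h (d ∘ outEdge) e2
    bridge-intertwines γ≉0 α≉0 d₃≈d₄ U₂ =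
      sym (x*[y-z]≈0⇒y≈z (*-nonZero γ≉0 α≉0) (x+y*z≈0⇒x≈0 (x≈y⇒x∙y⁻¹≈ε (sym d₃≈d₄)) (trans (sym expand) U₂)))
      where
      expand : frameApply h (d ⊙ handcuff₂ g) v2 ≈
               (gap g e0 e1 * gap g e3 e4) * (φ g e2 * d e3 - d e2 * φ h e2)
                 + (φ g e3 * (φ g e2 * gap g e0 e1)) * (d e4 - d e3)
      expand = solve 8 (λ γ a₂ a₃ a₄ b₂ d₂ d₃ d₄ →
        d₃ :* (:- (a₄ :* (a₂ :* γ))) :+ d₄ :* (a₃ :* (a₂ :* γ)) :- b₂ :* (d₂ :* (γ :* (a₃ :- a₄)))
          := (γ :* (a₃ :- a₄)) :* (a₂ :* d₃ :- d₂ :* b₂) :+ (a₃ :* (a₂ :* γ)) :* (d₄ :- d₃))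
        refl (gap g e0 e1) (φ g e2) (φ g e3) (φ g e4) (φ h e2) (d e2) (d e3) (d e4)

  nullSpaceEquivalent⇒switchingEquivalent : ∀ g h → NoBalancedTwoCycle F g →
    NullSpaceEquivalent (frameMatrix F g) (frameMatrix F h) → SwitchingEquivalent F g h
  nullSpaceEquivalent⇒switchingEquivalent g h (unbalanced₀₁ , unbalanced₃₄) (d , d≉0 , null⇔) =
    intertwining⇒switchingEquivalent g h (d ∘ outEdge) (d≉0 ∘ outEdge) intertwines
    where
    γ≉0 : NonZero F (gap g e0 e1)
    γ≉0 = unbalanced⇒gap≉0 g e0 e1 (φ-nonzero g e1) unbalanced₀₁
    α≉0 : NonZero F (gap g e3 e4)
    α≉0 = unbalanced⇒gap≉0 g e3 e4 (φ-nonzero g e4) unbalanced₃₄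
    scaled : ∀ x → (∀ v → frameApply g x v ≈ 0#) → ∀ v → frameApply h (d ⊙ x) v ≈ 0#
    scaled x = to (inNullSpace-frameMatrix h (d ⊙ x)) ∘ to (null⇔ x) ∘ from (inNullSpace-frameMatrix g x)
    U : ∀ v → frameApply h (d ⊙ handcuff₂ g) v ≈ 0#
    U = scaled (handcuff₂ g) (handcuff₂-null g)
    W : ∀ v → frameApply h (d ⊙ handcuff₅ g) v ≈ 0#
    W = scaled (handcuff₅ g) (handcuff₅-null g)
    d₀≈d₁ : d e0 ≈ d e1
    d₀≈d₁ = parallelScalings-agree g h d α≉0 (U 0F)
    d₃≈d₄ : d e3 ≈ d e4
    d₃≈d₄ = parallelScalings-agree (rotate g) (rotate h) (d ∘ rotateE) γ≉0 (W 2F)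
    pair₀₁ : Intertwines g h (d ∘ outEdge) e0 × Intertwines g h (d ∘ outEdge) e1
    pair₀₁ = parallelPair-intertwines g h d γ≉0 α≉0 (φ-nonzero g e5) d₀≈d₁ (U 1F) (W 1F)
    pair₃₄ : Intertwines g h (d ∘ outEdge) e3 × Intertwines g h (d ∘ outEdge) e4
    pair₃₄ = parallelPair-intertwines (rotate g) (rotate h) (d ∘ rotateE)
               α≉0 γ≉0 (φ-nonzero g e2) d₃≈d₄ (W 3F) (U 3F)
    intertwines : ∀ e → Intertwines g h (d ∘ outEdge) e
    intertwines 0F = proj₁ pair₀₁
    intertwines 1F = proj₂ pair₀₁
    intertwines 2F = bridge-intertwines g h d γ≉0 α≉0 d₃≈d₄ (U 2F)
    intertwines 3F = proj₁ pair₃₄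
    intertwines 4F = proj₂ pair₃₄
    intertwines 5F = bridge-intertwines (rotate g) (rotate h) (d ∘ rotateE) α≉0 γ≉0 d₀≈d₁ (W 0F)

  scaleRows : ∀ {m n k} → (Fin m → Carrier) → Vector (Fin m) k → Matrix F m n → Matrix F m n
  scaleRows ρ rs A = foldr (λ r → scaleRow F r (ρ r)) A rs

  scaleColumns : ∀ {m n k} → (Fin n → Carrier) → Vector (Fin n) k → Matrix F m n → Matrix F m n
  scaleColumns κ ks A = foldr (λ k → scaleColumn F k (κ k)) A ks

  scaleRows-projEquiv : ∀ {m n ρ} → (∀ r → NonZero F (ρ r)) →
    ∀ {k} (rs : Vector (Fin m) k) (A : Matrix F m n) → ProjEquiv F A (scaleRows ρ rs A)
  scaleRows-projEquiv ρ≉0 {ℕ.zero}  rs A = pe-≈ (λ _ _ → refl)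
  scaleRows-projEquiv ρ≉0 {ℕ.suc k} rs A =
    pe-trans (scaleRows-projEquiv ρ≉0 (rs ∘ suc) A) (pe-scaleRow _ (rs 0F) _ (ρ≉0 (rs 0F)))

  scaleColumns-projEquiv : ∀ {m n κ} → (∀ k → NonZero F (κ k)) →
    ∀ {l} (ks : Vector (Fin n) l) (A : Matrix F m n) → ProjEquiv F A (scaleColumns κ ks A)
  scaleColumns-projEquiv κ≉0 {ℕ.zero}  ks A = pe-≈ (λ _ _ → refl)
  scaleColumns-projEquiv κ≉0 {ℕ.suc l} ks A =
    pe-trans (scaleColumns-projEquiv κ≉0 (ks ∘ suc) A) (pe-scaleColumn _ (ks 0F) _ (κ≉0 (ks 0F)))

  scaleRows-all : ∀ {n} ρ (A : Matrix F 4 n) r k → scaleRows ρ id A r k ≡ ρ r * A r k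
  scaleRows-all ρ A 0F k = ≡.refl
  scaleRows-all ρ A 1F k = ≡.refl
  scaleRows-all ρ A 2F k = ≡.refl
  scaleRows-all ρ A 3F k = ≡.refl

  scaleColumns-all : ∀ {m} κ (A : Matrix F m 6) r k → scaleColumns κ id A r k ≡ A r k * κ k
  scaleColumns-all κ A r 0F = ≡.refl
  scaleColumns-all κ A r 1F = ≡.refl
  scaleColumns-all κ A r 2F = ≡.refl
  scaleColumns-all κ A r 3F = ≡.refl
  scaleColumns-all κ A r 4F = ≡.refl
  scaleColumns-all κ A r 5F = ≡.refl

  rescale-projEquiv : ∀ (A : Matrix F 4 6) {ρ κ} → (∀ r → NonZero F (ρ r)) → (∀ k → NonZero F (κ k)) →
    ProjEquiv F A (λ r k → ρ r * A r k * κ k)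
  rescale-projEquiv A {ρ} {κ} ρ≉0 κ≉0 =
    pe-trans (scaleRows-projEquiv ρ≉0 id A) (pe-trans (scaleColumns-projEquiv κ≉0 id _) (pe-≈ λ r k →
      reflexive (≡.trans (scaleColumns-all κ _ r k) (≡.cong (_* κ k) (scaleRows-all ρ A r k)))))

  frameMatrix-switch : ∀ g h η → (∀ v → NonZero F (η v)) → (∀ e → φ h e ≈ switch F η g e) →
    ∀ v e → η v * frameMatrix F g v e * η (tail e) ⁻¹ ≈ frameMatrix F h v e
  frameMatrix-switch g h η η≉0 switched v e with v ≟ tail e | v ≟ head e
  ... | yes ≡.refl | _          = trans (*-congʳ (*-identityʳ _)) (inverseʳ _ (η≉0 v))
  ... | no _       | yes ≡.refl = trans (rearrange (η v) (φ g e) (η (tail e) ⁻¹)) (-‿cong (sym (switched e)))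
    where
    rearrange : ∀ y a x → y * - a * x ≈ - (x * a * y)
    rearrange = solve 3 (λ y a x → y :* (:- a) :* x := :- (x :* a :* y)) refl
  ... | no _       | no _       = trans (*-congʳ (zeroʳ (η v))) (zeroˡ _)

  switchingEquivalent⇒projEquiv : ∀ g h → SwitchingEquivalent F g h →
    ProjEquiv F (frameMatrix F g) (frameMatrix F h)
  switchingEquivalent⇒projEquiv g h (η , η≉0 , switched) =
    pe-trans (rescale-projEquiv (frameMatrix F g) η≉0 (λ e → ⁻¹-nonZero (η≉0 (tail e))))
             (pe-≈ (frameMatrix-switch g h η η≉0 switched))

mainTheorem14 : {c ℓ : Level} (F : Field c ℓ) (φ ψ : GainFunction F) →
    NoBalancedTwoCycle F φ →
    (ProjEquiv F (frameMatrix F φ) (frameMatrix F ψ) ⇔ SwitchingEquivalent F φ ψ)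
mainTheorem14 F φ ψ unbalanced = mk⇔
  (nullSpaceEquivalent⇒switchingEquivalent F φ ψ unbalanced ∘ projEquiv⇒nullSpaceEquivalent F)
  (switchingEquivalent⇒projEquiv F φ ψ)
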